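{- Let $A,B,C$ be positive integers with $\gcd(A,B,C)=1$. For every $n\ge 0$ there is a bijection between the large tandem excursions of length $n$ with parameters $(A,B,C)$ and the large tandem excursions of length $n$ with parameters $(C,B,A)$.
   Context: For positive integers $A,B,C$ with $\gcd(A,B,C)=1$, a large tandem walk with parameters $(A,B,C)$ is a walk in $\mathbb{Z}^2$ starting at $(0,0)$ using steps from $\{(A,0),(-B,B),(0,-C)\}$ all of whose points lie in the quarter plane $\{(x,y)\in\mathbb{Z}^2:x,y\ge0\}$; a large tandem excursion is such a walk ending at $(0,0)$; its length is its number of steps. -}

module Defs where

open import Data.Nat using (ℕ)
open import Data.Integer using (ℤ; +_; -_; _+_; _≤_; 0ℤ)
open import Data.List using (List; []; _∷_; length)
open import Data.List.Relation.Unary.All using (All)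
open import Data.Product using (Σ; _×_; _,_)
open import Relation.Binary.PropositionalEquality using (_≡_)

data Step : Set where
  east  : Step
  nw    : Step
  south : Step

Point : Set
Point = ℤ × ℤ

stepVec : ℕ → ℕ → ℕ → Step → Point
stepVec A B C east  = (+ A , 0ℤ)
stepVec A B C nw    = (- (+ B) , + B)
stepVec A B C south = (0ℤ , - (+ C))

addP : Point → Point → Point
addP (x , y) (u , v) = (x + u , y + v)

visited : ℕ → ℕ → ℕ → Point → List Step → List Point
visited A B C p []       = []
visited A B C p (s ∷ w) = let q = addP p (stepVec A B C s) in q ∷ visited A B C q w

endpoint : ℕ → ℕ → ℕ → Point → List Step → Point
endpoint A B C p []       = p
endpoint A B C p (s ∷ w) = endpoint A B C (addP p (stepVec A B C s)) w

InQuarterPlane : Point → Set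
InQuarterPlane (x , y) = (0ℤ ≤ x) × (0ℤ ≤ y)

origin : Point
origin = (0ℤ , 0ℤ)

-- a large tandem walk (from the origin, which is in the quarter plane) stays in the quarter plane
IsTandemWalk : ℕ → ℕ → ℕ → List Step → Set
IsTandemWalk A B C w = All InQuarterPlane (visited A B C origin w)

IsTandemExcursion : ℕ → ℕ → ℕ → List Step → Set
IsTandemExcursion A B C w = IsTandemWalk A B C w × (endpoint A B C origin w ≡ origin)

Excursions : ℕ → ℕ → ℕ → ℕ → Set
Excursions A B C n = Σ (List Step) (λ w → (length w ≡ n) × IsTandemExcursion A B C w)

-- Reverse time and exchange the two coordinates.  Under (x , y) ↦ (y , x) the steps of
-- (A,B,C) traversed backwards, −(A,0), −(−B,B), −(0,−C), become (0,−A), (−B,B), (C,0):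
-- exactly the steps of (C,B,A).  Reading an excursion backwards with east and south
-- exchanged therefore gives an excursion for (C,B,A) visiting the swapped points, and
-- doing this twice gives the original back.
module Submission where

open import Defs
open import Data.Nat using (ℕ; _<_)
open import Data.Nat.GCD using (gcd)
open import Function.Bundles using (_⤖_; mk↔ₛ′)
open import Function.Base using (_∘_)
open import Function.Properties.Inverse using (↔⇒⤖)
open import Relation.Binary.PropositionalEquality
  using (_≡_; refl; sym; trans; cong; cong₂; subst; module ≡-Reasoning)
open import Relation.Nullary using (Irrelevant)
open import Axiom.UniquenessOfIdentityProofs using (module Decidable⇒UIP)
open import Data.Product using (_,_; proj₁; swap)
open import Data.Product.Properties using (≡-dec)
open import Data.List using (List; []; _∷_; _∷ʳ_; map; reverse; length)
open import Data.List.Properties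
  using (unfold-reverse; reverse-involutive; reverse-map; map-∘; map-cong; map-id; length-reverse; length-map)
import Data.List.Relation.Unary.All as All
open import Data.List.Relation.Unary.All using (All; []; _∷_)
open import Data.List.Relation.Unary.All.Properties using (∷ʳ⁺)
open import Data.Integer using (ℤ; 0ℤ; _+_)
import Data.Integer.Properties as ℤᵖ
import Data.Nat.Properties as ℕᵖ
open import Algebra.Properties.AbelianGroup ℤᵖ.+-0-abelianGroup using (//-rightDividesˡ; //-rightDividesʳ)

dual : Step → Step
dual east  = south
dual nw    = nw
dual south = east

dual-involutive : ∀ s → dual (dual s) ≡ s
dual-involutive east  = refl
dual-involutive nw    = refl
dual-involutive south = refl

reflect : List Step → List Step
reflect = reverse ∘ map dual

reflect-∷ : ∀ s w → reflect (s ∷ w) ≡ reflect w ∷ʳ dual s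
reflect-∷ s w = unfold-reverse (dual s) (map dual w)

reflect-involutive : ∀ w → reflect (reflect w) ≡ w
reflect-involutive w = begin
  reverse (map dual (reverse (map dual w)))  ≡⟨ cong reverse (reverse-map dual (map dual w)) ⟩
  reverse (reverse (map dual (map dual w)))  ≡⟨ reverse-involutive _ ⟩
  map dual (map dual w)                      ≡⟨ map-∘ w ⟨
  map (dual ∘ dual) w                        ≡⟨ map-cong dual-involutive w ⟩
  map (λ s → s) w                            ≡⟨ map-id w ⟩
  w                                          ∎
  where open ≡-Reasoning

length-reflect : ∀ w → length (reflect w) ≡ length w
length-reflect w = begin
  length (reverse (map dual w))  ≡⟨ length-reverse (map dual w) ⟩
  length (map dual w)            ≡⟨ length-map dual w ⟩
  length w                       ∎
  where open ≡-Reasoning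

module _ (A B C : ℕ) where

  endpoint-∷ʳ : ∀ p w s → endpoint A B C p (w ∷ʳ s) ≡ addP (endpoint A B C p w) (stepVec A B C s)
  endpoint-∷ʳ p []      s = refl
  endpoint-∷ʳ p (t ∷ w) s = endpoint-∷ʳ _ w s

  visited-∷ʳ : ∀ p w s →
    visited A B C p (w ∷ʳ s) ≡ visited A B C p w ∷ʳ addP (endpoint A B C p w) (stepVec A B C s)
  visited-∷ʳ p []      s = refl
  visited-∷ʳ p (t ∷ w) s = cong (_ ∷_) (visited-∷ʳ _ w s)

x+0+0≡x : ∀ (x : ℤ) → (x + 0ℤ) + 0ℤ ≡ x
x+0+0≡x x = trans (ℤᵖ.+-identityʳ _) (ℤᵖ.+-identityʳ x)

module _ (A B C : ℕ) where

  dual-step-undoes-step : ∀ p s →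
    addP (swap (addP p (stepVec A B C s))) (stepVec C B A (dual s)) ≡ swap p
  dual-step-undoes-step (x , y) east  = cong₂ _,_ (x+0+0≡x y) (//-rightDividesʳ _ x)
  dual-step-undoes-step (x , y) nw    = cong₂ _,_ (//-rightDividesʳ _ y) (//-rightDividesˡ _ x)
  dual-step-undoes-step (x , y) south = cong₂ _,_ (//-rightDividesˡ _ y) (x+0+0≡x x)

  endpoint-reflect : ∀ p w → endpoint C B A (swap (endpoint A B C p w)) (reflect w) ≡ swap p
  endpoint-reflect p []      = refl
  endpoint-reflect p (s ∷ w) = begin
    endpoint C B A q (reflect (s ∷ w))             ≡⟨ cong (endpoint C B A q) (reflect-∷ s w) ⟩
    endpoint C B A q (reflect w ∷ʳ dual s)         ≡⟨ endpoint-∷ʳ C B A q (reflect w) (dual s) ⟩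
    addP (endpoint C B A q (reflect w)) (stepVec C B A (dual s))
                                                   ≡⟨ cong (λ r → addP r (stepVec C B A (dual s))) (endpoint-reflect _ w) ⟩
    addP (swap (addP p (stepVec A B C s))) (stepVec C B A (dual s))
                                                   ≡⟨ dual-step-undoes-step p s ⟩
    swap p                                         ∎
    where
    open ≡-Reasoning
    q = swap (endpoint A B C p (s ∷ w))

  -- The last point of the reflected walk is the swapped start, hence the hypothesis on p.
  visited-reflect : ∀ p w → InQuarterPlane p → All InQuarterPlane (visited A B C p w) →
    All InQuarterPlane (visited C B A (swap (endpoint A B C p w)) (reflect w))
  visited-reflect p []      _  _             = []
  visited-reflect p (s ∷ w) p∈Q (p′∈Q ∷ w∈Q) =
    subst (All InQuarterPlane) (sym visited-reflect-∷)
      (∷ʳ⁺ (visited-reflect _ w p′∈Q w∈Q) (subst InQuarterPlane (sym last-point) (swap p∈Q)))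
    where
    q = swap (endpoint A B C p (s ∷ w))
    q′ = endpoint C B A q (reflect w)

    last = addP q′ (stepVec C B A (dual s))

    visited-reflect-∷ : visited C B A q (reflect (s ∷ w)) ≡ visited C B A q (reflect w) ∷ʳ last
    visited-reflect-∷ =
      trans (cong (visited C B A q) (reflect-∷ s w)) (visited-∷ʳ C B A q (reflect w) (dual s))

    last-point : last ≡ swap p
    last-point =
      trans (cong (λ r → addP r (stepVec C B A (dual s))) (endpoint-reflect _ w)) (dual-step-undoes-step p s)

origin∈Q : InQuarterPlane origin
origin∈Q = ℤᵖ.≤-refl , ℤᵖ.≤-refl

InQuarterPlane-irrelevant : ∀ {p} → Irrelevant (InQuarterPlane p)
InQuarterPlane-irrelevant (x≥0 , y≥0) (x≥0′ , y≥0′) = cong₂ _,_ (ℤᵖ.≤-irrelevant x≥0 x≥0′) (ℤᵖ.≤-irrelevant y≥0 y≥0′)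

Point-≡-irrelevant : ∀ {p q : Point} → Irrelevant (p ≡ q)
Point-≡-irrelevant = Decidable⇒UIP.≡-irrelevant (≡-dec ℤᵖ._≟_ ℤᵖ._≟_)

IsTandemExcursion-irrelevant : ∀ A B C w → Irrelevant (IsTandemExcursion A B C w)
IsTandemExcursion-irrelevant A B C w (w∈Q , w↦0) (w∈Q′ , w↦0′) =
  cong₂ _,_ (All.irrelevant InQuarterPlane-irrelevant w∈Q w∈Q′) (Point-≡-irrelevant w↦0 w↦0′)

excursion-≡ : ∀ {A B C n} {e e′ : Excursions A B C n} → proj₁ e ≡ proj₁ e′ → e ≡ e′
excursion-≡ {A} {B} {C} {e = w , |w|≡n , t} {e′ = .w , |w|≡n′ , t′} refl =
  cong₂ (λ l t → w , l , t) (ℕᵖ.≡-irrelevant |w|≡n |w|≡n′) (IsTandemExcursion-irrelevant A B C w t t′)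

reflectExcursion : ∀ {A B C n} → Excursions A B C n → Excursions C B A n
reflectExcursion {A} {B} {C} (w , |w|≡n , w∈Q , w↦0) =
  reflect w ,
  trans (length-reflect w) |w|≡n ,
  subst (λ e → All InQuarterPlane (visited C B A (swap e) (reflect w))) w↦0
    (visited-reflect A B C origin w origin∈Q w∈Q) ,
  subst (λ e → endpoint C B A (swap e) (reflect w) ≡ origin) w↦0 (endpoint-reflect A B C origin w)

lemma2 : (A B C : ℕ) → 0 < A → 0 < B → 0 < C → gcd (gcd A B) C ≡ 1 →
    (n : ℕ) → Excursions A B C n ⤖ Excursions C B A n
lemma2 A B C _ _ _ _ n = ↔⇒⤖ (mk↔ₛ′ reflectExcursion reflectExcursion
  (λ e → excursion-≡ (reflect-involutive (proj₁ e)))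
  (λ e → excursion-≡ (reflect-involutive (proj₁ e))))
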